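{- Suppose the twisted Coxeter system $(W,S,*)$ is irreducible and of finite or affine type. Then $(W,S,*)$ is simply braided if and only if either $s^*\neq s$ for all $s\in S$; or $*=\mathrm{id}$ and $W$ has type $\mathsf{A}_n$ or $\tilde{\mathsf{A}}_n$; or $W$ has type $\tilde{\mathsf{A}}_2$, $\tilde{\mathsf{C}}_2$, $\tilde{\mathsf{G}}_2$, or $\mathsf{I}_2(n)$ for some $3\le n\le\infty$.
   Context: A twisted Coxeter system $(W,S,*)$ is a Coxeter system $(W,S)$ with a group automorphism $w\mapsto w^*$ of $W$ satisfying $(w^*)^*=w$ and $S^*=S$. It is irreducible if $*$ acts transitively on the connected components of the Coxeter graph of $(W,S)$ (equivalently, $W$ is irreducible or has two irreducible factors interchanged by $*$); finite or affine type refers to the Coxeter types of these components. It is simply braided if there is no $J\subseteq S$ with $J^*=J$ such that $(W_J,J)$, $W_J=\langle J\rangle$, is of Coxeter type $\mathsf{BC}_3$, $\mathsf{D}_4$ or $\mathsf{H}_3$ with $*$ fixing $J$ pointwise, or of Coxeter type $\mathsf{A}_3$ with $*$ acting on $J$ as the nontrivial graph automorphism. -}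

module Defs where

open import Data.Nat using (ℕ; zero; suc; _≤_; _∸_; _≟_)
open import Data.Fin using (Fin; toℕ; opposite)
open import Data.Fin.Subset using (Subset; _∈_)
open import Data.Bool using (Bool; if_then_else_; _∧_; _∨_)
open import Data.List using (List; []; _∷_; map; upTo)
open import Data.Product using (Σ; ∃; _×_; _,_)
open import Data.Sum using (_⊎_)
open import Data.Unit using (⊤)
open import Data.Empty using (⊥)
open import Relation.Nullary using (¬_; does)
open import Relation.Binary.PropositionalEquality using (_≡_; _≢_)
open import Relation.Binary.Construct.Closure.ReflexiveTransitive using (Star)

data Label : Set where
  ⟨_⟩ : ℕ → Label
  ∞   : Label

AtLeast2 : Label → Set
AtLeast2 ⟨ k ⟩ = 2 ≤ k
AtLeast2 ∞     = ⊤

CoxMatrix : ℕ → Set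
CoxMatrix n = Fin n → Fin n → Label

IsCoxeterMatrix : ∀ {n} → CoxMatrix n → Set
IsCoxeterMatrix {n} m =
  (∀ s t → m s t ≡ m t s) ×
  (∀ s → m s s ≡ ⟨ 1 ⟩) ×
  (∀ s t → s ≢ t → AtLeast2 (m s t))

-- The restriction to S of the twist *: an involution of S which, being
-- the restriction of a group automorphism of W, preserves the Coxeter
-- matrix (and conversely every such involution extends uniquely).
IsTwist : ∀ {n} → CoxMatrix n → (Fin n → Fin n) → Set
IsTwist {n} m σ = (∀ s → σ (σ s) ≡ s) × (∀ s t → m (σ s) (σ t) ≡ m s t)

record CoxType : Set where
  field
    rank : ℕ
    mat  : Fin rank → Fin rank → Label
open CoxType public

-- label of the (unordered) pair {i,j} from an edge list; first match wins,
-- pairs not listed get label 2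
look : List (ℕ × ℕ × Label) → ℕ → ℕ → Label
look [] i j = ⟨ 2 ⟩
look ((a , b , l) ∷ es) i j =
  if (does (a ≟ i) ∧ does (b ≟ j)) ∨ (does (a ≟ j) ∧ does (b ≟ i))
  then l else look es i j

graph : (k : ℕ) → List (ℕ × ℕ × Label) → CoxType
graph k es = record
  { rank = k
  ; mat  = λ i j → if does (toℕ i ≟ toℕ j) then ⟨ 1 ⟩ else look es (toℕ i) (toℕ j) }

chain : ℕ → List (ℕ × ℕ × Label)
chain k = map (λ i → i , suc i , ⟨ 3 ⟩) (upTo k)

typeA : ℕ → CoxType
typeA n = graph n (chain (n ∸ 1))

typeBC : ℕ → CoxType
typeBC n = graph n ((n ∸ 2 , n ∸ 1 , ⟨ 4 ⟩) ∷ chain (n ∸ 1))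

typeD : ℕ → CoxType
typeD n = graph n ((n ∸ 3 , n ∸ 1 , ⟨ 3 ⟩) ∷ chain (n ∸ 2))

typeE : ℕ → CoxType
typeE n = graph n ((2 , n ∸ 1 , ⟨ 3 ⟩) ∷ chain (n ∸ 2))

typeF4 : CoxType
typeF4 = graph 4 ((1 , 2 , ⟨ 4 ⟩) ∷ chain 3)

typeH : ℕ → CoxType
typeH n = graph n ((0 , 1 , ⟨ 5 ⟩) ∷ chain (n ∸ 1))

typeI2 : Label → CoxType
typeI2 l = graph 2 ((0 , 1 , l) ∷ [])

-- affine types (X̃_n has n+1 nodes)
typeÃ : ℕ → CoxType
typeÃ zero          = graph 1 []          -- unused (n ≥ 1 is required)
typeÃ (suc zero)    = graph 2 ((0 , 1 , ∞) ∷ [])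
typeÃ (suc (suc k)) = graph (3 + k) ((0 , suc (suc k) , ⟨ 3 ⟩) ∷ chain (suc (suc k)))
  where open import Data.Nat using (_+_)

typeB̃ : ℕ → CoxType
typeB̃ n = graph (suc n) ((n ∸ 2 , n ∸ 1 , ⟨ 4 ⟩) ∷ (1 , n , ⟨ 3 ⟩) ∷ chain (n ∸ 1))

typeC̃ : ℕ → CoxType
typeC̃ n = graph (suc n) ((0 , 1 , ⟨ 4 ⟩) ∷ (n ∸ 1 , n , ⟨ 4 ⟩) ∷ chain n)

typeD̃ : ℕ → CoxType
typeD̃ n = graph (suc n) ((n ∸ 3 , n ∸ 1 , ⟨ 3 ⟩) ∷ (1 , n , ⟨ 3 ⟩) ∷ chain (n ∸ 2))

typeẼ6 : CoxType
typeẼ6 = graph 7 ((2 , 5 , ⟨ 3 ⟩) ∷ (5 , 6 , ⟨ 3 ⟩) ∷ chain 4)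

typeẼ7 : CoxType
typeẼ7 = graph 8 ((3 , 7 , ⟨ 3 ⟩) ∷ chain 6)

typeẼ8 : CoxType
typeẼ8 = graph 9 ((2 , 8 , ⟨ 3 ⟩) ∷ chain 7)

typeF̃4 : CoxType
typeF̃4 = graph 5 ((2 , 3 , ⟨ 4 ⟩) ∷ chain 4)

typeG̃2 : CoxType
typeG̃2 = graph 3 ((1 , 2 , ⟨ 6 ⟩) ∷ chain 2)

data FinAffType : Set where
  A   : (n : ℕ) → 1 ≤ n → FinAffType
  BC  : (n : ℕ) → 2 ≤ n → FinAffType
  D   : (n : ℕ) → 4 ≤ n → FinAffType
  E6 E7 E8 F4 H3 H4 : FinAffType
  I2  : (k : ℕ) → 3 ≤ k → FinAffType
  Ã   : (n : ℕ) → 1 ≤ n → FinAffType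
  B̃   : (n : ℕ) → 3 ≤ n → FinAffType
  C̃   : (n : ℕ) → 2 ≤ n → FinAffType
  D̃   : (n : ℕ) → 4 ≤ n → FinAffType
  Ẽ6 Ẽ7 Ẽ8 F̃4 G̃2 : FinAffType

diagram : FinAffType → CoxType
diagram (A n _)  = typeA n
diagram (BC n _) = typeBC n
diagram (D n _)  = typeD n
diagram E6       = typeE 6
diagram E7       = typeE 7
diagram E8       = typeE 8
diagram F4       = typeF4
diagram H3       = typeH 3
diagram H4       = typeH 4
diagram (I2 k _) = typeI2 ⟨ k ⟩
diagram (Ã n _)  = typeÃ n
diagram (B̃ n _)  = typeB̃ n
diagram (C̃ n _)  = typeC̃ n
diagram (D̃ n _)  = typeD̃ n
diagram Ẽ6      = typeẼ6
diagram Ẽ7      = typeẼ7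
diagram Ẽ8      = typeẼ8
diagram F̃4      = typeF̃4
diagram G̃2      = typeG̃2

HasTypeVia : ∀ {n} → CoxMatrix n → (Fin n → Set) → (X : CoxType) →
             (Fin (rank X) → Fin n) → Set
HasTypeVia {n} m J X f =
  (∀ {i j} → f i ≡ f j → i ≡ j) ×
  (∀ i → J (f i)) ×
  (∀ s → J s → ∃ λ i → f i ≡ s) ×
  (∀ i j → m (f i) (f j) ≡ mat X i j)

HasType : ∀ {n} → CoxMatrix n → (Fin n → Set) → CoxType → Set
HasType m J X = Σ _ λ f → HasTypeVia m J X f

WHasType : ∀ {n} → CoxMatrix n → CoxType → Set
WHasType m X = HasType m (λ _ → ⊤) X

Edge : ∀ {n} → CoxMatrix n → Fin n → Fin n → Set
Edge m s t = m s t ≢ ⟨ 2 ⟩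

Conn : ∀ {n} → CoxMatrix n → Fin n → Fin n → Set
Conn m = Star (Edge m)

-- * acts transitively on the connected components: every component is
-- the component of s or its image under *, for any s.
Irreducible : ∀ {n} → CoxMatrix n → (Fin n → Fin n) → Set
Irreducible m σ = ∀ s t → Conn m s t ⊎ Conn m s (σ t)

FiniteOrAffine : ∀ {n} → CoxMatrix n → Set
FiniteOrAffine m = ∀ s → Σ FinAffType λ T → HasType m (Conn m s) (diagram T)

StableUnder : ∀ {n} → (Fin n → Fin n) → Subset n → Set
StableUnder σ J = (∀ s → s ∈ J → σ s ∈ J) × (∀ t → t ∈ J → ∃ λ s → s ∈ J × σ s ≡ t)

BadSubset : ∀ {n} → CoxMatrix n → (Fin n → Fin n) → Subset n → Set
BadSubset m σ J =
  StableUnder σ J ×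
  ( ( (HasType m (_∈ J) (typeBC 3) ⊎ HasType m (_∈ J) (typeD 4) ⊎ HasType m (_∈ J) (typeH 3))
      × (∀ s → s ∈ J → σ s ≡ s) )
  ⊎ -- type A_3, * acting as the nontrivial diagram automorphism i ↦ 2 - i
    (Σ _ λ f → HasTypeVia m (_∈ J) (typeA 3) f × (∀ i → σ (f i) ≡ f (opposite i))) )

SimplyBraided : ∀ {n} → CoxMatrix n → (Fin n → Fin n) → Set
SimplyBraided m σ = ¬ (∃ λ J → BadSubset m σ J)

RHS : ∀ {n} → CoxMatrix n → (Fin n → Fin n) → Set
RHS m σ =
  (∀ s → σ s ≢ s)
  ⊎ ((∀ s → σ s ≡ s) ×
      ((∃ λ k → 1 ≤ k × WHasType m (typeA k)) ⊎ (∃ λ k → 1 ≤ k × WHasType m (typeÃ k))))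
  ⊎ WHasType m (typeÃ 2)
  ⊎ WHasType m (typeC̃ 2)
  ⊎ WHasType m typeG̃2
  ⊎ (∃ λ k → 3 ≤ k × WHasType m (typeI2 ⟨ k ⟩))
  ⊎ WHasType m (typeI2 ∞)

-- If * fixes a generator s, irreducibility makes the Coxeter graph connected, so W has a
-- single finite or affine type. Apart from the listed exceptions, every such diagram has "simple
-- twin edges": two edges at a node carrying the same label are simple (label 3) and their far
-- ends are not joined. So a non-trivial * fixing s fixes some u joined to a moved v, and
-- v - u - v* is an A₃ on which * acts as the diagram flip. If * is trivial, every type other
-- than A_n and Ã_n contains BC₃, D₄ or H₃ (the larger members of each family by peeling off end
-- nodes). Conversely, A_n and Ã_n have only simple edges and degrees at most 2, so they contain
-- none of these; the small exceptional types are checked by evaluation; and a fixed-point-free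
-- * fixes no subset pointwise and fixes the middle node of no A₃.

module Submission where

open import Defs
open import Data.Empty using (⊥; ⊥-elim)
open import Data.Unit using (tt)
open import Data.Bool using (if_then_else_)
open import Data.Product using (Σ; ∃; ∃₂; _×_; _,_; proj₁; proj₂)
open import Data.Sum as Sum using (_⊎_; inj₁; inj₂; [_,_]′)
open import Data.Nat using (ℕ; zero; suc; pred; parity; _+_; _∸_; _<_; _≤_; _≟_; z≤n; s≤s)
open import Data.Nat.Properties using (<-irrefl; <-asym; <⇒≱; m<1+n⇒m≤n; ≤-refl; m≤n⇒m≤1+n)
open import Data.Parity.Base using (Parity; 0ℙ; 1ℙ; _⁻¹)
open import Data.Parity.Properties using (p≢p⁻¹; suc-homo-⁻¹)
open import Data.Fin as Fin using (Fin; zero; suc; toℕ; inject₁; opposite; #_)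
open import Data.Fin.Properties
  using ( suc-injective; toℕ-injective; toℕ-inject₁; toℕ<n; inject₁-injective; opposite-involutive
        ; all?; any?; ¬∀⟶∃¬; pigeonhole )
  renaming (_≟_ to _≟ᶠ_; <-irrefl to <ᶠ-irrefl)
open import Data.Fin.Subset using (Subset; _∈_)
open import Data.List using (List; []; _∷_; map; applyUpTo)
open import Data.List.Properties using (map-applyUpTo; map-upTo)
open import Data.List.Membership.Propositional using () renaming (_∈_ to _∈ˡ_)
open import Data.List.Membership.Propositional.Properties using (∈-map⁻; ∈-upTo⁻)
open import Data.List.Relation.Unary.Any using (here; there)
open import Data.Vec as Vec using (Vec; []; _∷_)
open import Data.Vec.Properties using (lookup∘tabulate; lookup⇒[]=; []=⇒lookup)
open import Function.Bundles using (_⇔_; mk⇔)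
open import Function.Definitions using (Injective)
open import Relation.Binary.Definitions using (DecidableEquality)
open import Relation.Binary.Construct.Closure.ReflexiveTransitive using (ε; _◅_; gmap)
open import Relation.Binary.PropositionalEquality
  using (_≡_; _≢_; refl; sym; trans; cong; cong₂; subst; subst₂; module ≡-Reasoning)
open import Relation.Nullary using (¬_; Dec; yes; no; does; contradiction)
open import Relation.Nullary.Decidable
  using (dec-true; dec-false; _×-dec_; _⊎-dec_; _→-dec_; ¬?; map′; True; toWitness)

_≟ᴸ_ : DecidableEquality Label
⟨ a ⟩ ≟ᴸ ⟨ b ⟩ with a ≟ b
... | yes refl = yes refl
... | no a≢b   = no λ { refl → a≢b refl }
⟨ _ ⟩ ≟ᴸ ∞     = no λ ()
∞     ≟ᴸ ⟨ _ ⟩ = no λ ()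
∞     ≟ᴸ ∞     = yes refl

Entry : Set
Entry = ℕ × ℕ × Label

Joins : ℕ → ℕ → ℕ → ℕ → Set
Joins a b i j = (a ≡ i × b ≡ j) ⊎ (a ≡ j × b ≡ i)

joins? : ∀ a b i j → Dec (Joins a b i j)
joins? a b i j = (a ≟ i ×-dec b ≟ j) ⊎-dec (a ≟ j ×-dec b ≟ i)

Touches : ℕ → ℕ → ℕ → Set
Touches x a b = x ≡ a ⊎ x ≡ b

joins-touches : ∀ {a b x y} → Joins a b x y → Touches x a b
joins-touches (inj₁ (refl , _)) = inj₁ refl
joins-touches (inj₂ (_ , refl)) = inj₂ refl

joins-other-end : ∀ {a b x y z} → Joins a b x y → Joins a b x z → x ≢ y → x ≢ z → y ≡ z
joins-other-end (inj₁ (refl , refl)) (inj₁ (refl , refl)) _   _   = refl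
joins-other-end (inj₁ (refl , refl)) (inj₂ (refl , refl)) _   x≢z = contradiction refl x≢z
joins-other-end (inj₂ (refl , refl)) (inj₁ (refl , refl)) x≢y _   = contradiction refl x≢y
joins-other-end (inj₂ (refl , refl)) (inj₂ (refl , refl)) _   _   = refl

look-here : ∀ {a b i j} l es → Joins a b i j → look ((a , b , l) ∷ es) i j ≡ l
look-here {a} {b} {i} {j} l es p =
  cong (if_then l else look es i j) (dec-true (joins? a b i j) p)

look-there : ∀ {a b i j} l es → ¬ Joins a b i j → look ((a , b , l) ∷ es) i j ≡ look es i j
look-there {a} {b} {i} {j} l es ¬p =
  cong (if_then l else look es i j) (dec-false (joins? a b i j) ¬p)

look-cons : ∀ e {es es′ i j} → look es i j ≡ look es′ i j → look (e ∷ es) i j ≡ look (e ∷ es′) i j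
look-cons (a , b , l) {i = i} {j} = cong (if does (joins? a b i j) then l else_)

data Source (es : List Entry) (i j : ℕ) : Set where
  source : ∀ {a b l} → (a , b , l) ∈ˡ es → Joins a b i j → look es i j ≡ l → Source es i j

look-source : ∀ es i j → look es i j ≢ ⟨ 2 ⟩ → Source es i j
look-source []              i j ≢2 = contradiction refl ≢2
look-source ((a , b , l) ∷ es) i j ≢2 with joins? a b i j
... | yes p = source (here refl) p (look-here l es p)
... | no ¬p with look-source es i j (λ e → ≢2 (trans (look-there l es ¬p) e))
...   | source mem p eq = source (there mem) p (trans (look-there l es ¬p) eq)

¬joins-beyond : ∀ {a b i j} → i < b → j < b → ¬ Joins a b i j
¬joins-beyond i<b j<b (inj₁ (_ , refl)) = <-irrefl refl j<b
¬joins-beyond i<b j<b (inj₂ (_ , refl)) = <-irrefl refl i<b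

shift : Entry → Entry
shift (a , b , l) = suc a , suc b , l

look-shift-cons : ∀ e {es es′ i j} → look es′ (suc i) (suc j) ≡ look es i j →
                  look (shift e ∷ es′) (suc i) (suc j) ≡ look (e ∷ es) i j
look-shift-cons (a , b , l) {i = i} {j} = cong (if does (joins? a b i j) then l else_)

look-shift : ∀ es i j → look (map shift es) (suc i) (suc j) ≡ look es i j
look-shift []      i j = refl
look-shift (e ∷ es) i j = look-shift-cons e {es} {map shift es} (look-shift es i j)

chain-entry : ∀ {K a b l} → (a , b , l) ∈ˡ chain K → b ≡ suc a × a < K × l ≡ ⟨ 3 ⟩
chain-entry {K} mem with ∈-map⁻ (λ i → i , suc i , ⟨ 3 ⟩) mem
... | _ , a∈upTo , refl = refl , ∈-upTo⁻ a∈upTo , refl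

chain-suc : ∀ k → chain (suc k) ≡ (0 , 1 , ⟨ 3 ⟩) ∷ map shift (chain k)
chain-suc k = cong ((0 , 1 , ⟨ 3 ⟩) ∷_) (begin
  map step (applyUpTo suc k)      ≡⟨ map-applyUpTo suc step k ⟩
  applyUpTo (λ i → shift (step i)) k ≡⟨ map-applyUpTo step shift k ⟨
  map shift (applyUpTo step k)   ≡⟨ cong (map shift) (map-upTo step k) ⟨
  map shift (chain k)            ∎)
  where
  open ≡-Reasoning
  step : ℕ → Entry
  step i = i , suc i , ⟨ 3 ⟩

look-chain-suc : ∀ k i j → look (chain (suc k)) (suc i) (suc j) ≡ look (chain k) i j
look-chain-suc k i j =
  trans (cong (λ es → look es (suc i) (suc j)) (chain-suc k)) (look-shift (chain k) i j)

toℕ-≢ : ∀ {r} {i j : Fin r} → i ≢ j → toℕ i ≢ toℕ j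
toℕ-≢ i≢j e = i≢j (toℕ-injective e)

mat-diagonal : ∀ {r} es (i : Fin r) → mat (graph r es) i i ≡ ⟨ 1 ⟩
mat-diagonal es i = cong (if_then ⟨ 1 ⟩ else look es (toℕ i) (toℕ i)) (dec-true (toℕ i ≟ toℕ i) refl)

mat-off-diagonal : ∀ {r} es {i j : Fin r} → i ≢ j → mat (graph r es) i j ≡ look es (toℕ i) (toℕ j)
mat-off-diagonal es {i} {j} i≢j =
  cong (if_then ⟨ 1 ⟩ else look es (toℕ i) (toℕ j)) (dec-false (toℕ i ≟ toℕ j) (toℕ-≢ i≢j))

infix 4 _⊑_
record _⊑_ (B X : CoxType) : Set where
  constructor subdiagram
  field
    embed     : Fin (rank B) → Fin (rank X)
    injective : Injective _≡_ _≡_ embed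
    preserves : ∀ i j → mat X (embed i) (embed j) ≡ mat B i j

⊑-refl : ∀ {X} → X ⊑ X
⊑-refl = subdiagram (λ i → i) (λ e → e) λ _ _ → refl

⊑-trans : ∀ {B X Y} → B ⊑ X → X ⊑ Y → B ⊑ Y
⊑-trans (subdiagram g g-inj g-mat) (subdiagram h h-inj h-mat) =
  subdiagram (λ i → h (g i)) (λ e → g-inj (h-inj e)) λ i j → trans (h-mat (g i) (g j)) (g-mat i j)

Obstruction : CoxType → Set
Obstruction X = typeBC 3 ⊑ X ⊎ typeD 4 ⊑ X ⊎ typeH 3 ⊑ X

⊑-graph-suc : ∀ {r} es es′ → (∀ i j → look es′ (suc i) (suc j) ≡ look es i j) →
              graph r es ⊑ graph (suc r) es′
⊑-graph-suc es es′ agree = subdiagram Fin.suc suc-injective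
  λ i j → cong (if does (toℕ i ≟ toℕ j) then ⟨ 1 ⟩ else_) (agree (toℕ i) (toℕ j))

⊑-graph-shift-cons : ∀ {r} e es es′ → (∀ i j → look es′ (suc i) (suc j) ≡ look es i j) →
                     graph r (e ∷ es) ⊑ graph (suc r) (shift e ∷ es′)
⊑-graph-shift-cons e es es′ agree =
  ⊑-graph-suc (e ∷ es) (shift e ∷ es′) λ i j → look-shift-cons e {es} {es′} (agree i j)

⊑-graph-inject₁ : ∀ {r} es es′ → (∀ i j → i < r → j < r → look es′ i j ≡ look es i j) →
                  graph r es ⊑ graph (suc r) es′
⊑-graph-inject₁ es es′ agree = subdiagram inject₁ inject₁-injective λ i j →
  begin
    mat (graph _ es′) (inject₁ i) (inject₁ j)
      ≡⟨ cong₂ (λ x y → if does (x ≟ y) then ⟨ 1 ⟩ else look es′ x y) (toℕ-inject₁ i) (toℕ-inject₁ j) ⟩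
    (if does (toℕ i ≟ toℕ j) then ⟨ 1 ⟩ else look es′ (toℕ i) (toℕ j))
      ≡⟨ cong (if does (toℕ i ≟ toℕ j) then ⟨ 1 ⟩ else_) (agree (toℕ i) (toℕ j) (toℕ<n i) (toℕ<n j)) ⟩
    mat (graph _ es) i j
  ∎
  where open ≡-Reasoning

BC-⊑-BC : ∀ n → typeBC (2 + n) ⊑ typeBC (3 + n)
BC-⊑-BC n =
  ⊑-graph-shift-cons (n , suc n , ⟨ 4 ⟩) (chain (suc n)) (chain (2 + n)) (look-chain-suc (suc n))

D-⊑-D : ∀ n → typeD (4 + n) ⊑ typeD (5 + n)
D-⊑-D n =
  ⊑-graph-shift-cons (suc n , 3 + n , ⟨ 3 ⟩) (chain (2 + n)) (chain (3 + n)) (look-chain-suc (2 + n))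

-- The leading entry (0, 1, 4) of C̃ joins no two successors, so it drops out by evaluation.
BC-⊑-C̃ : ∀ n → typeBC (2 + n) ⊑ typeC̃ (2 + n)
BC-⊑-C̃ n = ⊑-graph-suc (e ∷ chain (suc n)) ((0 , 1 , ⟨ 4 ⟩) ∷ shift e ∷ chain (2 + n)) λ i j →
  look-shift-cons e {chain (suc n)} {chain (2 + n)} (look-chain-suc (suc n) i j)
  where e = (n , suc n , ⟨ 4 ⟩)

BC-⊑-B̃ : ∀ n → typeBC n ⊑ typeB̃ n
BC-⊑-B̃ n = ⊑-graph-inject₁ (e ∷ chain (n ∸ 1)) (e ∷ (1 , n , ⟨ 3 ⟩) ∷ chain (n ∸ 1)) λ i j i<n j<n →
  look-cons e {(1 , n , ⟨ 3 ⟩) ∷ chain (n ∸ 1)} {chain (n ∸ 1)} {i} {j}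
    (look-there {1} {n} ⟨ 3 ⟩ (chain (n ∸ 1)) (¬joins-beyond i<n j<n))
  where e = (n ∸ 2 , n ∸ 1 , ⟨ 4 ⟩)

D-⊑-D̃ : ∀ n → typeD n ⊑ typeD̃ n
D-⊑-D̃ n = ⊑-graph-inject₁ (e ∷ chain (n ∸ 2)) (e ∷ (1 , n , ⟨ 3 ⟩) ∷ chain (n ∸ 2)) λ i j i<n j<n →
  look-cons e {(1 , n , ⟨ 3 ⟩) ∷ chain (n ∸ 2)} {chain (n ∸ 2)} {i} {j}
    (look-there {1} {n} ⟨ 3 ⟩ (chain (n ∸ 2)) (¬joins-beyond i<n j<n))
  where e = (n ∸ 3 , n ∸ 1 , ⟨ 3 ⟩)

BC₃-⊑-BC : ∀ k → typeBC 3 ⊑ typeBC (3 + k)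
BC₃-⊑-BC zero    = ⊑-refl
BC₃-⊑-BC (suc k) = ⊑-trans (BC₃-⊑-BC k) (BC-⊑-BC (suc k))

D₄-⊑-D : ∀ k → typeD 4 ⊑ typeD (4 + k)
D₄-⊑-D zero    = ⊑-refl
D₄-⊑-D (suc k) = ⊑-trans (D₄-⊑-D k) (D-⊑-D k)

-- Simple twin edges

TwinEdgesSimple : ∀ {n} → CoxMatrix n → Set
TwinEdgesSimple {n} m = ∀ (a b c : Fin n) → a ≢ b → b ≢ c → a ≢ c →
  m a b ≢ ⟨ 2 ⟩ → m a b ≡ m a c → m a b ≡ ⟨ 3 ⟩ × m b c ≡ ⟨ 2 ⟩

record TriangleFree (es : List Entry) : Set where
  constructor triangleFree
  field
    no-triangle : ∀ {a b c} → a ≢ b → b ≢ c → a ≢ c →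
                  look es a b ≢ ⟨ 2 ⟩ → look es a c ≢ ⟨ 2 ⟩ → look es b c ≢ ⟨ 2 ⟩ → ⊥

NonSimpleDisjoint : List Entry → Set
NonSimpleDisjoint es = ∀ {a b l a′ b′ l′ x} → (a , b , l) ∈ˡ es → (a′ , b′ , l′) ∈ˡ es →
  l ≢ ⟨ 3 ⟩ → l′ ≢ ⟨ 3 ⟩ → Touches x a b → Touches x a′ b′ → a ≡ a′ × b ≡ b′

twinEdgesSimple-graph : ∀ {r} es → TriangleFree es → NonSimpleDisjoint es →
                        TwinEdgesSimple (mat (graph r es))
twinEdgesSimple-graph es (triangleFree no-triangle) disjoint a b c a≢b b≢c a≢c ab≢2 ab≡ac =
  ab≡3 , trans (mat-off-diagonal es b≢c) bc≡2
  where
  look-ab = mat-off-diagonal es a≢b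
  look-ac≡ab : look es (toℕ a) (toℕ c) ≡ look es (toℕ a) (toℕ b)
  look-ac≡ab = trans (sym (mat-off-diagonal es a≢c)) (trans (sym ab≡ac) look-ab)
  ab≢2′ : look es (toℕ a) (toℕ b) ≢ ⟨ 2 ⟩
  ab≢2′ e = ab≢2 (trans look-ab e)
  ac≢2′ : look es (toℕ a) (toℕ c) ≢ ⟨ 2 ⟩
  ac≢2′ e = ab≢2′ (trans (sym look-ac≡ab) e)
  ab≡3 : mat (graph _ es) a b ≡ ⟨ 3 ⟩
  ab≡3 with look es (toℕ a) (toℕ b) ≟ᴸ ⟨ 3 ⟩
  ... | yes ≡3 = trans look-ab ≡3
  ... | no ≢3 with look-source es _ _ ab≢2′ | look-source es _ _ ac≢2′
  ...   | source mem₁ p₁ eq₁ | source mem₂ p₂ eq₂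
    with disjoint mem₁ mem₂ (λ e → ≢3 (trans eq₁ e)) (λ e → ≢3 (trans (sym look-ac≡ab) (trans eq₂ e)))
                  (joins-touches p₁) (joins-touches p₂)
  ...     | refl , refl = contradiction (joins-other-end p₁ p₂ (toℕ-≢ a≢b) (toℕ-≢ a≢c)) (toℕ-≢ b≢c)
  bc≡2 : look es (toℕ b) (toℕ c) ≡ ⟨ 2 ⟩
  bc≡2 with look es (toℕ b) (toℕ c) ≟ᴸ ⟨ 2 ⟩
  ... | yes ≡2 = ≡2
  ... | no ≢2 = ⊥-elim (no-triangle (toℕ-≢ a≢b) (toℕ-≢ b≢c) (toℕ-≢ a≢c) ab≢2′ ac≢2′ ≢2)

ProperColouring : (ℕ → Parity) → List Entry → Set
ProperColouring col es = ∀ {a b l} → (a , b , l) ∈ˡ es → col a ≢ col b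

no-three-distinct-parities : ∀ {p q r : Parity} → p ≢ q → p ≢ r → q ≢ r → ⊥
no-three-distinct-parities {0ℙ} {0ℙ}      p≢q _   _   = p≢q refl
no-three-distinct-parities {1ℙ} {1ℙ}      p≢q _   _   = p≢q refl
no-three-distinct-parities {0ℙ} {1ℙ} {0ℙ} _   p≢r _   = p≢r refl
no-three-distinct-parities {0ℙ} {1ℙ} {1ℙ} _   _   q≢r = q≢r refl
no-three-distinct-parities {1ℙ} {0ℙ} {0ℙ} _   _   q≢r = q≢r refl
no-three-distinct-parities {1ℙ} {0ℙ} {1ℙ} _   p≢r _   = p≢r refl

properColouring⇒triangleFree : ∀ {col es} → ProperColouring col es → TriangleFree es
properColouring⇒triangleFree {col} {es} proper = triangleFree no-triangle
  where
  joined : ∀ {a b x y} → col a ≢ col b → Joins a b x y → col x ≢ col y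
  joined ne (inj₁ (refl , refl)) = ne
  joined ne (inj₂ (refl , refl)) = λ e → ne (sym e)
  no-triangle : ∀ {a b c} → a ≢ b → b ≢ c → a ≢ c →
                look es a b ≢ ⟨ 2 ⟩ → look es a c ≢ ⟨ 2 ⟩ → look es b c ≢ ⟨ 2 ⟩ → ⊥
  no-triangle _ _ _ ab≢2 ac≢2 bc≢2
    with look-source es _ _ ab≢2 | look-source es _ _ ac≢2 | look-source es _ _ bc≢2
  ... | source m₁ p₁ _ | source m₂ p₂ _ | source m₃ p₃ _ =
    no-three-distinct-parities (joined (proper m₁) p₁) (joined (proper m₂) p₂) (joined (proper m₃) p₃)

parity-suc : ∀ n → parity n ≢ parity (suc n)
parity-suc n e = p≢p⁻¹ (parity (suc n)) (trans (sym e) (sym (suc-homo-⁻¹ n)))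

chain-colouring : ∀ K → ProperColouring parity (chain K)
chain-colouring K {a} mem with chain-entry {K} mem
... | refl , _ , _ = parity-suc a

colouring-∷ : ∀ {col a b l es} → col a ≢ col b → ProperColouring col es →
              ProperColouring col ((a , b , l) ∷ es)
colouring-∷ ab _ (here refl) = ab
colouring-∷ _  proper (there mem) = proper mem

colouring-swap : ∀ {col e e′ es} → ProperColouring col (e ∷ e′ ∷ es) → ProperColouring col (e′ ∷ e ∷ es)
colouring-swap proper (here refl)         = proper (there (here refl))
colouring-swap proper (there (here refl)) = proper (here refl)
colouring-swap proper (there (there mem)) = proper (there (there mem))

Avoids : ℕ → List Entry → Set
Avoids x es = ∀ {a b l} → (a , b , l) ∈ˡ es → ¬ Touches x a b

chain-avoids : ∀ {K x} → K < x → Avoids x (chain K)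
chain-avoids {K} K<x mem with chain-entry {K} mem
... | refl , a<K , _ = λ
  { (inj₁ refl) → <-asym a<K K<x
  ; (inj₂ refl) → <⇒≱ a<K (m<1+n⇒m≤n K<x) }

avoids-∷ : ∀ {x a b l es} → a ≢ x → b ≢ x → Avoids x es → Avoids x ((a , b , l) ∷ es)
avoids-∷ a≢x _   _      (here refl) (inj₁ refl) = a≢x refl
avoids-∷ _   b≢x _      (here refl) (inj₂ refl) = b≢x refl
avoids-∷ _   _   avoids (there mem)             = avoids mem

recolour : (ℕ → Parity) → ℕ → Parity → ℕ → Parity
recolour col x p y = if does (y ≟ x) then p else col y

recolour-other : ∀ col {x} p {y} → y ≢ x → recolour col x p y ≡ col y
recolour-other col {x} p {y} y≢x = cong (if_then p else col y) (dec-false (y ≟ x) y≢x)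

pendant-colouring : ∀ {col a b l es} → ProperColouring col es → Avoids b es → a ≢ b →
                    ProperColouring (recolour col b (col a ⁻¹)) ((a , b , l) ∷ es)
pendant-colouring {col} {a} {b} proper avoids a≢b (here refl) e =
  p≢p⁻¹ (col a) (trans (sym (recolour-other col _ a≢b)) (trans e
    (cong (if_then col a ⁻¹ else col b) (dec-true (b ≟ b) refl))))
pendant-colouring {col} proper avoids _ (there mem) e =
  proper mem (trans (sym (recolour-other col _ (λ c≡b → avoids mem (inj₁ (sym c≡b)))))
                    (trans e (recolour-other col _ (λ d≡b → avoids mem (inj₂ (sym d≡b))))))

AllSimple : List Entry → Set
AllSimple es = ∀ {a b l} → (a , b , l) ∈ˡ es → l ≡ ⟨ 3 ⟩

chain-simple : ∀ K → AllSimple (chain K)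
chain-simple K mem = proj₂ (proj₂ (chain-entry {K} mem))

simple-∷ : ∀ {a b es} → AllSimple es → AllSimple ((a , b , ⟨ 3 ⟩) ∷ es)
simple-∷ _      (here refl) = refl
simple-∷ simple (there mem) = simple mem

simple⇒nonSimpleDisjoint : ∀ {es} → AllSimple es → NonSimpleDisjoint es
simple⇒nonSimpleDisjoint simple mem _ l≢3 = contradiction (simple mem) l≢3

lone-nonSimple : ∀ {e es} → AllSimple es → NonSimpleDisjoint (e ∷ es)
lone-nonSimple _      (here refl) (here refl) _ _   _ _ = refl , refl
lone-nonSimple simple (here refl) (there mem) _ l≢3 _ _ = contradiction (simple mem) l≢3
lone-nonSimple simple (there mem) _           l≢3 _ _ _ = contradiction (simple mem) l≢3

separated-nonSimple : ∀ {a b l a′ b′ l′ es} → AllSimple es →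
  (∀ {x} → Touches x a b → ¬ Touches x a′ b′) →
  NonSimpleDisjoint ((a , b , l) ∷ (a′ , b′ , l′) ∷ es)
separated-nonSimple _ _   (here refl)         (here refl)         _ _ _  _  = refl , refl
separated-nonSimple _ sep (here refl)         (there (here refl)) _ _ tx tx′ = contradiction tx′ (sep tx)
separated-nonSimple _ sep (there (here refl)) (here refl)         _ _ tx tx′ = contradiction tx (sep tx′)
separated-nonSimple _ _   (there (here refl)) (there (here refl)) _ _ _  _  = refl , refl
separated-nonSimple simple _ (here refl)         (there (there mem)) _ l≢3 _ _ = contradiction (simple mem) l≢3
separated-nonSimple simple _ (there (here refl)) (there (there mem)) _ l≢3 _ _ = contradiction (simple mem) l≢3
separated-nonSimple simple _ (there (there mem)) _                   l≢3 _ _ _ = contradiction (simple mem) l≢3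

Step : ℕ → ℕ → Set
Step x y = suc x ≡ y ⊎ suc y ≡ x

step-parity : ∀ {x y} → Step x y → parity x ≢ parity y
step-parity {x} (inj₁ refl) = parity-suc x
step-parity {y = y} (inj₂ refl) = λ e → parity-suc y (sym e)

Adjacent : ℕ → ℕ → ℕ → Set
Adjacent N x y = Joins 0 N x y ⊎ Step x y

adjacent-sym : ∀ {N x y} → Adjacent N x y → Adjacent N y x
adjacent-sym (inj₁ (inj₁ (p , q))) = inj₁ (inj₂ (p , q))
adjacent-sym (inj₁ (inj₂ (p , q))) = inj₁ (inj₁ (p , q))
adjacent-sym (inj₂ (inj₁ p))       = inj₂ (inj₂ p)
adjacent-sym (inj₂ (inj₂ p))       = inj₂ (inj₁ p)

cycle-adjacent : ∀ N {x y} → look ((0 , N , ⟨ 3 ⟩) ∷ chain N) x y ≢ ⟨ 2 ⟩ → Adjacent N x y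
cycle-adjacent N {x} {y} ≢2 with look-source ((0 , N , ⟨ 3 ⟩) ∷ chain N) x y ≢2
... | source (here refl) p _ = inj₁ p
... | source (there mem) p _ with chain-entry {N} mem | p
...   | refl , _ , _ | inj₁ (refl , refl) = inj₂ (inj₁ refl)
...   | refl , _ , _ | inj₂ (refl , refl) = inj₂ (inj₂ refl)

-- A node adjacent to both ends 0 and N of the closing edge would be 1 = N - 1.
cycle-apex : ∀ j {x y z} → Joins 0 (3 + j) x y → z ≢ x → z ≢ y →
             Adjacent (3 + j) x z → Adjacent (3 + j) y z → ⊥
cycle-apex j (inj₁ (refl , refl)) z≢x z≢y xz yz = apex₀ z≢x z≢y xz yz
  where
  apex₀ : ∀ {z} → z ≢ 0 → z ≢ 3 + j → Adjacent (3 + j) 0 z → Adjacent (3 + j) (3 + j) z → ⊥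
  apex₀ _   z≢N (inj₁ (inj₁ (_ , e)))  _ = z≢N (sym e)
  apex₀ z≢0 _   (inj₁ (inj₂ (e , _)))  _ = z≢0 (sym e)
  apex₀ _   _   (inj₂ (inj₂ ()))       _
  apex₀ _   _   (inj₂ (inj₁ refl)) (inj₁ (inj₁ (() , _)))
  apex₀ _   _   (inj₂ (inj₁ refl)) (inj₁ (inj₂ (() , _)))
  apex₀ _   _   (inj₂ (inj₁ refl)) (inj₂ (inj₁ ()))
  apex₀ _   _   (inj₂ (inj₁ refl)) (inj₂ (inj₂ ()))
cycle-apex j (inj₂ (refl , refl)) z≢x z≢y xz yz =
  cycle-apex j (inj₁ (refl , refl)) z≢y z≢x yz xz

-- Ã_N is an odd cycle for even N, so parity alone cannot exclude triangles through {0, N}.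
cycle-no-triangle : ∀ j {a b c} → a ≢ b → b ≢ c → a ≢ c →
  Adjacent (3 + j) a b → Adjacent (3 + j) a c → Adjacent (3 + j) b c → ⊥
cycle-no-triangle j a≢b b≢c a≢c (inj₁ ab) ac bc =
  cycle-apex j ab (λ e → a≢c (sym e)) (λ e → b≢c (sym e)) ac bc
cycle-no-triangle j a≢b b≢c a≢c (inj₂ ab) (inj₁ ac) bc =
  cycle-apex j ac (λ e → a≢b (sym e)) b≢c (inj₂ ab) (adjacent-sym bc)
cycle-no-triangle j a≢b b≢c a≢c (inj₂ ab) (inj₂ ac) (inj₁ bc) =
  cycle-apex j bc a≢b a≢c (adjacent-sym (inj₂ ab)) (adjacent-sym (inj₂ ac))
cycle-no-triangle j a≢b b≢c a≢c (inj₂ ab) (inj₂ ac) (inj₂ bc) =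
  no-three-distinct-parities (step-parity ab) (step-parity ac) (step-parity bc)

cycle-triangleFree : ∀ j → TriangleFree ((0 , 3 + j , ⟨ 3 ⟩) ∷ chain (3 + j))
cycle-triangleFree j = triangleFree λ a≢b b≢c a≢c ab ac bc →
  cycle-no-triangle j a≢b b≢c a≢c (cycle-adjacent _ ab) (cycle-adjacent _ ac) (cycle-adjacent _ bc)

twinEdgesSimple-A : ∀ n → TwinEdgesSimple (mat (typeA n))
twinEdgesSimple-A n = twinEdgesSimple-graph (chain (n ∸ 1))
  (properColouring⇒triangleFree (chain-colouring (n ∸ 1)))
  (simple⇒nonSimpleDisjoint (chain-simple (n ∸ 1)))

twinEdgesSimple-BC : ∀ k → TwinEdgesSimple (mat (typeBC (2 + k)))
twinEdgesSimple-BC k = twinEdgesSimple-graph ((k , suc k , ⟨ 4 ⟩) ∷ chain (suc k))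
  (properColouring⇒triangleFree (colouring-∷ (parity-suc k) (chain-colouring (suc k))))
  (lone-nonSimple (chain-simple (suc k)))

twinEdgesSimple-D : ∀ k → TwinEdgesSimple (mat (typeD (4 + k)))
twinEdgesSimple-D k = twinEdgesSimple-graph ((suc k , 3 + k , ⟨ 3 ⟩) ∷ chain (2 + k))
  (properColouring⇒triangleFree
    (pendant-colouring (chain-colouring (2 + k)) (chain-avoids ≤-refl) λ ()))
  (simple⇒nonSimpleDisjoint (simple-∷ (chain-simple (2 + k))))

twinEdgesSimple-Ã : ∀ j → TwinEdgesSimple (mat (typeÃ (3 + j)))
twinEdgesSimple-Ã j = twinEdgesSimple-graph ((0 , 3 + j , ⟨ 3 ⟩) ∷ chain (3 + j))
  (cycle-triangleFree j)
  (simple⇒nonSimpleDisjoint (simple-∷ (chain-simple (3 + j))))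

twinEdgesSimple-B̃ : ∀ k → TwinEdgesSimple (mat (typeB̃ (3 + k)))
twinEdgesSimple-B̃ k =
  twinEdgesSimple-graph ((suc k , 2 + k , ⟨ 4 ⟩) ∷ (1 , 3 + k , ⟨ 3 ⟩) ∷ chain (2 + k))
    (properColouring⇒triangleFree (colouring-swap
      (pendant-colouring (colouring-∷ (parity-suc (suc k)) (chain-colouring (2 + k)))
                         (avoids-∷ (λ ()) (λ ()) (chain-avoids ≤-refl)) λ ())))
    (lone-nonSimple (simple-∷ (chain-simple (2 + k))))

twinEdgesSimple-C̃ : ∀ k → TwinEdgesSimple (mat (typeC̃ (3 + k)))
twinEdgesSimple-C̃ k =
  twinEdgesSimple-graph ((0 , 1 , ⟨ 4 ⟩) ∷ (2 + k , 3 + k , ⟨ 4 ⟩) ∷ chain (3 + k))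
    (properColouring⇒triangleFree
      (colouring-∷ (parity-suc 0) (colouring-∷ (parity-suc (2 + k)) (chain-colouring (3 + k)))))
    (separated-nonSimple (chain-simple (3 + k)) λ
      { (inj₁ refl) (inj₁ ()) ; (inj₁ refl) (inj₂ ())
      ; (inj₂ refl) (inj₁ ()) ; (inj₂ refl) (inj₂ ()) })

twinEdgesSimple-D̃ : ∀ k → TwinEdgesSimple (mat (typeD̃ (4 + k)))
twinEdgesSimple-D̃ k =
  twinEdgesSimple-graph ((suc k , 3 + k , ⟨ 3 ⟩) ∷ (1 , 4 + k , ⟨ 3 ⟩) ∷ chain (2 + k))
    (properColouring⇒triangleFree (colouring-swap
      (pendant-colouring
        (pendant-colouring (chain-colouring (2 + k)) (chain-avoids ≤-refl) λ ())
        (avoids-∷ (λ ()) (λ ()) (chain-avoids (m≤n⇒m≤1+n ≤-refl))) λ ())))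
    (simple⇒nonSimpleDisjoint (simple-∷ (simple-∷ (chain-simple (2 + k)))))

twinEdgesSimple? : ∀ {n} (m : CoxMatrix n) → Dec (TwinEdgesSimple m)
twinEdgesSimple? m = all? λ a → all? λ b → all? λ c →
  ¬? (a ≟ᶠ b) →-dec ¬? (b ≟ᶠ c) →-dec ¬? (a ≟ᶠ c) →-dec ¬? (m a b ≟ᴸ ⟨ 2 ⟩) →-dec
  (m a b ≟ᴸ m a c) →-dec ((m a b ≟ᴸ ⟨ 3 ⟩) ×-dec (m b c ≟ᴸ ⟨ 2 ⟩))

twinEdgesSimple-by-check : ∀ X → {_ : True (twinEdgesSimple? (mat X))} → TwinEdgesSimple (mat X)
twinEdgesSimple-by-check X {ok} = toWitness ok

SubdiagramVia : (B X : CoxType) → (Fin (rank B) → Fin (rank X)) → Set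
SubdiagramVia B X g = (∀ i j → g i ≡ g j → i ≡ j) × (∀ i j → mat X (g i) (g j) ≡ mat B i j)

subdiagramVia? : ∀ B X g → Dec (SubdiagramVia B X g)
subdiagramVia? B X g =
  (all? λ i → all? λ j → (g i ≟ᶠ g j) →-dec (i ≟ᶠ j)) ×-dec
  (all? λ i → all? λ j → mat X (g i) (g j) ≟ᴸ mat B i j)

⊑-by-check : ∀ B X (v : Vec (Fin (rank X)) (rank B)) →
             {_ : True (subdiagramVia? B X (Vec.lookup v))} → B ⊑ X
⊑-by-check B X v {ok} with toWitness ok
... | injective , preserves = subdiagram (Vec.lookup v) (injective _ _) preserves

all-vectors? : ∀ {r} n {P : Vec (Fin r) n → Set} → (∀ v → Dec (P v)) → Dec (∀ v → P v)
all-vectors? zero    P? = map′ (λ p → λ { [] → p }) (λ f → f []) (P? [])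
all-vectors? (suc n) P? = map′ (λ f → λ { (x ∷ v) → f x v }) (λ f x v → f (x ∷ v))
                               (all? λ x → all-vectors? n λ v → P? (x ∷ v))

⋢-by-check : ∀ B X →
  {_ : True (all-vectors? (rank B) λ v → ¬? (subdiagramVia? B X (Vec.lookup v)))} → ¬ (B ⊑ X)
⋢-by-check B X {ok} (subdiagram g injective preserves) =
  toWitness ok (Vec.tabulate g) (injective′ , preserves′)
  where
  g≗ : ∀ i → Vec.lookup (Vec.tabulate g) i ≡ g i
  g≗ = lookup∘tabulate g
  injective′ : ∀ i j → Vec.lookup (Vec.tabulate g) i ≡ Vec.lookup (Vec.tabulate g) j → i ≡ j
  injective′ i j e = injective (trans (sym (g≗ i)) (trans e (g≗ j)))
  preserves′ : ∀ i j → mat X (Vec.lookup (Vec.tabulate g) i) (Vec.lookup (Vec.tabulate g) j) ≡ mat B i j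
  preserves′ i j rewrite g≗ i | g≗ j = preserves i j

-- Unobstructed diagrams

AtMost3 : Label → Set
AtMost3 ⟨ k ⟩ = k ≤ 3
AtMost3 ∞     = ⊥

simple-graph-labels : ∀ {r} es → AllSimple es → ∀ (i j : Fin r) → AtMost3 (mat (graph r es) i j)
simple-graph-labels es simple i j with i ≟ᶠ j
... | yes refl = subst AtMost3 (sym (mat-diagonal es i)) (s≤s z≤n)
... | no i≢j = subst AtMost3 (sym (mat-off-diagonal es i≢j)) look-at-most-3
  where
  look-at-most-3 : AtMost3 (look es (toℕ i) (toℕ j))
  look-at-most-3 with look es (toℕ i) (toℕ j) ≟ᴸ ⟨ 2 ⟩
  ... | yes ≡2 = subst AtMost3 (sym ≡2) (s≤s (s≤s z≤n))
  ... | no ≢2 with look-source es _ _ ≢2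
  ...   | source mem _ ≡l = subst AtMost3 (sym (trans ≡l (simple mem))) ≤-refl

⋢-simple-graph : ∀ {r es} B p q → AllSimple es → ¬ AtMost3 (mat B p q) → ¬ (B ⊑ graph r es)
⋢-simple-graph {es = es} B p q simple large (subdiagram g _ preserves) =
  large (subst AtMost3 (preserves p q) (simple-graph-labels es simple (g p) (g q)))

⋢-rank : ∀ {B X} → rank X < rank B → ¬ (B ⊑ X)
⋢-rank lt (subdiagram g injective _) with pigeonhole lt g
... | i , j , i<j , e = <ᶠ-irrefl (injective e) i<j

two-of-three : ∀ {A : Set} {p q x y z : A} → x ≡ p ⊎ x ≡ q → y ≡ p ⊎ y ≡ q → z ≡ p ⊎ z ≡ q →
               x ≡ y ⊎ x ≡ z ⊎ y ≡ z
two-of-three (inj₁ refl) (inj₁ refl) _           = inj₁ refl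
two-of-three (inj₂ refl) (inj₂ refl) _           = inj₁ refl
two-of-three (inj₁ refl) (inj₂ refl) (inj₁ refl) = inj₂ (inj₁ refl)
two-of-three (inj₁ refl) (inj₂ refl) (inj₂ refl) = inj₂ (inj₂ refl)
two-of-three (inj₂ refl) (inj₁ refl) (inj₁ refl) = inj₂ (inj₂ refl)
two-of-three (inj₂ refl) (inj₁ refl) (inj₂ refl) = inj₂ (inj₁ refl)

-- The centre of D₄ would need three distinct neighbours.
⋢-D₄-degree≤2 : ∀ {r} es (next prev : ℕ → ℕ) →
  (∀ {x y} → y < r → x ≢ y → look es x y ≢ ⟨ 2 ⟩ → y ≡ next x ⊎ y ≡ prev x) →
  ¬ (typeD 4 ⊑ graph r es)
⋢-D₄-degree≤2 {r} es next prev neighbour (subdiagram g injective preserves) =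
  leaves-distinct (two-of-three (adjacent (# 0) refl) (adjacent (# 2) refl) (adjacent (# 3) refl))
  where
  centre = toℕ (g (# 1))
  adjacent : ∀ leaf → mat (typeD 4) (# 1) leaf ≡ ⟨ 3 ⟩ →
             toℕ (g leaf) ≡ next centre ⊎ toℕ (g leaf) ≡ prev centre
  adjacent leaf ≡3 = neighbour (toℕ<n (g leaf)) (toℕ-≢ centre≢leaf) λ e →
    contradiction (trans (sym ≡3) (trans (sym (preserves (# 1) leaf))
                                        (trans (mat-off-diagonal es centre≢leaf) e)))
                  λ ()
    where
    centre≢leaf : g (# 1) ≢ g leaf
    centre≢leaf e with injective e
    ... | refl = contradiction ≡3 λ ()
  distinct : ∀ {i j} → i ≢ j → toℕ (g i) ≢ toℕ (g j)
  distinct i≢j = toℕ-≢ λ e → i≢j (injective e)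
  leaves-distinct : toℕ (g (# 0)) ≡ toℕ (g (# 2)) ⊎ toℕ (g (# 0)) ≡ toℕ (g (# 3)) ⊎
                    toℕ (g (# 2)) ≡ toℕ (g (# 3)) → ⊥
  leaves-distinct (inj₁ e)        = distinct (λ ()) e
  leaves-distinct (inj₂ (inj₁ e)) = distinct (λ ()) e
  leaves-distinct (inj₂ (inj₂ e)) = distinct (λ ()) e

chain-neighbour : ∀ K {x y} → look (chain K) x y ≢ ⟨ 2 ⟩ → y ≡ suc x ⊎ y ≡ pred x
chain-neighbour K {x} {y} ≢2 with look-source (chain K) x y ≢2
... | source mem p _ with chain-entry {K} mem | p
...   | refl , _ , _ | inj₁ (refl , refl) = inj₁ refl
...   | refl , _ , _ | inj₂ (refl , refl) = inj₂ refl

cycle-next : ℕ → ℕ → ℕ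
cycle-next N x = if does (x ≟ N) then 0 else suc x

cycle-prev : ℕ → ℕ → ℕ
cycle-prev N zero    = N
cycle-prev N (suc x) = x

cycle-neighbour : ∀ N {x y} → y < suc N → Adjacent N x y → y ≡ cycle-next N x ⊎ y ≡ cycle-prev N x
cycle-neighbour N _ (inj₁ (inj₁ (refl , refl))) = inj₂ refl
cycle-neighbour N _ (inj₁ (inj₂ (refl , refl))) =
  inj₁ (sym (cong (if_then 0 else suc N) (dec-true (N ≟ N) refl)))
cycle-neighbour N {x} y≤N (inj₂ (inj₁ refl)) =
  inj₁ (sym (cong (if_then 0 else suc x) (dec-false (x ≟ N) λ { refl → <-irrefl refl y≤N })))
cycle-neighbour N _ (inj₂ (inj₂ refl)) = inj₂ refl

BC₃-large : ¬ AtMost3 (mat (typeBC 3) (# 1) (# 2))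
BC₃-large (s≤s (s≤s (s≤s ())))

H₃-large : ¬ AtMost3 (mat (typeH 3) (# 0) (# 1))
H₃-large (s≤s (s≤s (s≤s ())))

¬obstruction-simple-graph : ∀ {r es} → AllSimple es → ¬ (typeD 4 ⊑ graph r es) → ¬ Obstruction (graph r es)
¬obstruction-simple-graph simple ¬D₄ =
  [ ⋢-simple-graph (typeBC 3) (# 1) (# 2) simple BC₃-large
  , [ ¬D₄ , ⋢-simple-graph (typeH 3) (# 0) (# 1) simple H₃-large ]′ ]′

¬obstruction-rank≤2 : ∀ {X} → rank X ≤ 2 → ¬ Obstruction X
¬obstruction-rank≤2 r≤2 = [ ⋢-rank (s≤s r≤2) , [ ⋢-rank (m≤n⇒m≤1+n (s≤s r≤2)) , ⋢-rank (s≤s r≤2) ]′ ]′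

¬obstruction-A : ∀ k → ¬ Obstruction (typeA k)
¬obstruction-A k = ¬obstruction-simple-graph (chain-simple (k ∸ 1))
  (⋢-D₄-degree≤2 (chain (k ∸ 1)) suc pred λ _ _ → chain-neighbour (k ∸ 1))

¬obstruction-Ã : ∀ k → ¬ Obstruction (typeÃ k)
¬obstruction-Ã 0 = ¬obstruction-rank≤2 (s≤s z≤n)
¬obstruction-Ã 1 = ¬obstruction-rank≤2 ≤-refl
¬obstruction-Ã 2 =
  ¬obstruction-simple-graph {es = (0 , 2 , ⟨ 3 ⟩) ∷ chain 2} (simple-∷ (chain-simple 2)) (⋢-rank ≤-refl)
¬obstruction-Ã (suc (suc (suc j))) =
  ¬obstruction-simple-graph {es = cycle} (simple-∷ (chain-simple (3 + j)))
  (⋢-D₄-degree≤2 cycle (cycle-next (3 + j)) (cycle-prev (3 + j))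
    λ {x} {y} y<r _ ≢2 → cycle-neighbour (3 + j) y<r (cycle-adjacent (3 + j) {x} {y} ≢2))
  where cycle = (0 , 3 + j , ⟨ 3 ⟩) ∷ chain (3 + j)

image : ∀ {r n} → (Fin r → Fin n) → Subset n
image h = Vec.tabulate λ s → does (any? λ i → h i ≟ᶠ s)

∈-image : ∀ {r n} (h : Fin r → Fin n) i → h i ∈ image h
∈-image h i = lookup⇒[]= (h i) (image h)
  (trans (lookup∘tabulate _ (h i)) (dec-true (any? λ j → h j ≟ᶠ h i) (i , refl)))

image-preimage : ∀ {r n} (h : Fin r → Fin n) {s} → s ∈ image h → ∃ λ i → h i ≡ s
image-preimage h {s} s∈ with any? (λ i → h i ≟ᶠ s) | trans (sym (lookup∘tabulate _ s)) ([]=⇒lookup s∈)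
... | yes found | _ = found
... | no  _     | ()

image-hasType : ∀ {n} (m : CoxMatrix n) (X : CoxType) {h : Fin (rank X) → Fin n} →
  Injective _≡_ _≡_ h → (∀ i j → m (h i) (h j) ≡ mat X i j) → HasTypeVia m (_∈ image h) X h
image-hasType m X {h} injective preserves = injective , ∈-image h , (λ _ → image-preimage h) , preserves

image-stable : ∀ {r n} (σ : Fin n → Fin n) (h : Fin r → Fin n) (π : Fin r → Fin r) →
  (∀ i → π (π i) ≡ i) → (∀ i → σ (h i) ≡ h (π i)) → StableUnder σ (image h)
image-stable σ h π π-involutive σ∘h≗h∘π = closed , onto
  where
  closed : ∀ s → s ∈ image h → σ s ∈ image h
  closed s s∈ with image-preimage h s∈
  ... | i , refl = subst (_∈ image h) (sym (σ∘h≗h∘π i)) (∈-image h (π i))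
  onto : ∀ t → t ∈ image h → ∃ λ s → s ∈ image h × σ s ≡ t
  onto t t∈ with image-preimage h t∈
  ... | i , refl = h (π i) , ∈-image h (π i) , trans (σ∘h≗h∘π (π i)) (cong h (π-involutive i))

module WholeType {n} (m : CoxMatrix n) (X : CoxType) (W : WHasType m X) where

  node : Fin (rank X) → Fin n
  node = proj₁ W

  node-injective : Injective _≡_ _≡_ node
  node-injective = proj₁ (proj₂ W)

  node-preserves : ∀ i j → m (node i) (node j) ≡ mat X i j
  node-preserves = proj₂ (proj₂ (proj₂ (proj₂ W)))

  index : Fin n → Fin (rank X)
  index s = proj₁ (proj₁ (proj₂ (proj₂ (proj₂ W))) s tt)

  node-index : ∀ s → node (index s) ≡ s
  node-index s = proj₂ (proj₁ (proj₂ (proj₂ (proj₂ W))) s tt)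

  m≡mat-index : ∀ s t → m s t ≡ mat X (index s) (index t)
  m≡mat-index s t = trans (cong₂ m (sym (node-index s)) (sym (node-index t))) (node-preserves _ _)

  index-≢ : ∀ {s t} → s ≢ t → index s ≢ index t
  index-≢ {s} {t} s≢t e = s≢t (trans (sym (node-index s)) (trans (cong node e) (node-index t)))

  twinEdgesSimple : TwinEdgesSimple (mat X) → TwinEdgesSimple m
  twinEdgesSimple tes a b c a≢b b≢c a≢c ab≢2 ab≡ac =
    trans (m≡mat-index a b) (proj₁ twin) , trans (m≡mat-index b c) (proj₂ twin)
    where
    twin = tes (index a) (index b) (index c) (index-≢ a≢b) (index-≢ b≢c) (index-≢ a≢c)
             (λ e → ab≢2 (trans (m≡mat-index a b) e))
             (trans (sym (m≡mat-index a b)) (trans ab≡ac (m≡mat-index a c)))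

  parabolic⇒⊑ : ∀ {J B} → HasType m J B → B ⊑ X
  parabolic⇒⊑ (h , injective , _ , _ , preserves) =
    subdiagram (λ i → index (h i))
               (λ e → injective (trans (sym (node-index _)) (trans (cong node e) (node-index _))))
               (λ i j → trans (sym (m≡mat-index (h i) (h j))) (preserves i j))

  ⊑⇒parabolic : ∀ {B} → B ⊑ X → Σ (Fin (rank B) → Fin n) λ h →
                  Injective _≡_ _≡_ h × (∀ i j → m (h i) (h j) ≡ mat B i j)
  ⊑⇒parabolic (subdiagram g injective preserves) =
    (λ i → node (g i)) , (λ e → injective (node-injective e)) ,
    λ i j → trans (node-preserves (g i) (g j)) (preserves i j)

-- σ swaps the ends of the path v - u - σ v, whose labels 3, 3, 2 come from the twin edges at u.
A₃-bad-subset : ∀ {n} {m : CoxMatrix n} {σ : Fin n → Fin n} → IsCoxeterMatrix m → IsTwist m σ →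
  TwinEdgesSimple m → ∀ {u v} → σ u ≡ u → σ v ≢ v → Edge m u v → ∃ (BadSubset m σ)
A₃-bad-subset {n} {m} {σ} (symmetric , diagonal , _) (involutive , σ-preserves) tes {u} {v} fixed moved edge =
  image h , image-stable σ h opposite opposite-involutive σ∘h≗h∘opposite ,
  inj₂ (h , image-hasType m (typeA 3) h-injective h-preserves , σ∘h≗h∘opposite)
  where
  h : Fin 3 → Fin n
  h = Vec.lookup (v ∷ u ∷ σ v ∷ [])
  u≢v : u ≢ v
  u≢v refl = moved fixed
  v≢σv : v ≢ σ v
  v≢σv e = moved (sym e)
  u≢σv : u ≢ σ v
  u≢σv e = u≢v (trans (sym fixed) (trans (cong σ e) (involutive v)))
  uv≡uσv : m u v ≡ m u (σ v)
  uv≡uσv = trans (sym (σ-preserves u v)) (cong (λ x → m x (σ v)) fixed)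
  twin : m u v ≡ ⟨ 3 ⟩ × m v (σ v) ≡ ⟨ 2 ⟩
  twin = tes u v (σ v) u≢v v≢σv u≢σv edge uv≡uσv
  uσv≡3 : m u (σ v) ≡ ⟨ 3 ⟩
  uσv≡3 = trans (sym uv≡uσv) (proj₁ twin)
  σ∘h≗h∘opposite : ∀ i → σ (h i) ≡ h (opposite i)
  σ∘h≗h∘opposite zero             = refl
  σ∘h≗h∘opposite (suc zero)       = fixed
  σ∘h≗h∘opposite (suc (suc zero)) = involutive v
  h-injective : Injective _≡_ _≡_ h
  h-injective {zero}           {zero}           _ = refl
  h-injective {zero}           {suc zero}       e = contradiction (sym e) u≢v
  h-injective {zero}           {suc (suc zero)} e = contradiction e v≢σv
  h-injective {suc zero}       {zero}           e = contradiction e u≢v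
  h-injective {suc zero}       {suc zero}       _ = refl
  h-injective {suc zero}       {suc (suc zero)} e = contradiction e u≢σv
  h-injective {suc (suc zero)} {zero}           e = contradiction (sym e) v≢σv
  h-injective {suc (suc zero)} {suc zero}       e = contradiction (sym e) u≢σv
  h-injective {suc (suc zero)} {suc (suc zero)} _ = refl
  h-preserves : ∀ i j → m (h i) (h j) ≡ mat (typeA 3) i j
  h-preserves zero             zero             = diagonal v
  h-preserves zero             (suc zero)       = trans (symmetric v u) (proj₁ twin)
  h-preserves zero             (suc (suc zero)) = proj₂ twin
  h-preserves (suc zero)       zero             = proj₁ twin
  h-preserves (suc zero)       (suc zero)       = diagonal u
  h-preserves (suc zero)       (suc (suc zero)) = uσv≡3
  h-preserves (suc (suc zero)) zero             = trans (symmetric (σ v) v) (proj₂ twin)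
  h-preserves (suc (suc zero)) (suc zero)       = trans (symmetric (σ v) u) uσv≡3
  h-preserves (suc (suc zero)) (suc (suc zero)) = diagonal (σ v)

obstruction-bad-subset : ∀ {n} {m : CoxMatrix n} {σ : Fin n → Fin n} {X} → WHasType m X →
  (∀ s → σ s ≡ s) → Obstruction X → ∃ (BadSubset m σ)
obstruction-bad-subset {n} {m} {σ} {X} W trivial obstruction = bad obstruction
  where
  open WholeType m X W
  fixed-parabolic : ∀ {B} → B ⊑ X → Σ (Subset n) λ J → StableUnder σ J × HasType m (_∈ J) B
  fixed-parabolic sub with ⊑⇒parabolic sub
  ... | h , injective , preserves =
    image h , image-stable σ h (λ i → i) (λ _ → refl) (λ i → trivial (h i)) ,
    h , image-hasType m _ injective preserves
  bad : Obstruction X → ∃ (BadSubset m σ)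
  bad (inj₁ sub) with fixed-parabolic sub
  ... | J , stable , P = J , stable , inj₁ (inj₁ P , λ s _ → trivial s)
  bad (inj₂ (inj₁ sub)) with fixed-parabolic sub
  ... | J , stable , P = J , stable , inj₁ (inj₂ (inj₁ P) , λ s _ → trivial s)
  bad (inj₂ (inj₂ sub)) with fixed-parabolic sub
  ... | J , stable , P = J , stable , inj₁ (inj₂ (inj₂ P) , λ s _ → trivial s)

moving-edge : ∀ {n} {m : CoxMatrix n} (σ : Fin n → Fin n) {s t} → Conn m s t → σ s ≡ s → σ t ≢ t →
  ∃₂ λ u v → σ u ≡ u × σ v ≢ v × Edge m u v
moving-edge σ ε fixed moved = contradiction fixed moved
moving-edge σ {s} (_◅_ {j = s′} edge path) fixed moved with σ s′ ≟ᶠ s′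
... | yes fixed′ = moving-edge σ path fixed′ moved
... | no moved′  = s , s′ , fixed , moved′ , edge

connected-from-fixed : ∀ {n} {m : CoxMatrix n} {σ : Fin n → Fin n} → IsTwist m σ → Irreducible m σ →
  ∀ {s} → σ s ≡ s → ∀ t → Conn m s t
connected-from-fixed {m = m} {σ} (involutive , σ-preserves) irreducible {s} fixed t with irreducible s t
... | inj₁ path = path
... | inj₂ path = subst₂ (Conn m) fixed (involutive t)
  (gmap σ (λ {a} {b} edge e → edge (trans (sym (σ-preserves a b)) e)) path)

connected⇒WHasType : ∀ {n} {m : CoxMatrix n} {s X} → (∀ t → Conn m s t) →
                     HasType m (Conn m s) X → WHasType m X
connected⇒WHasType connected (f , injective , _ , onto , preserves) =
  f , injective , (λ _ → tt) , (λ t _ → onto t (connected t)) , preserves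

trivial-or-A₃ : ∀ {n} {m : CoxMatrix n} {σ : Fin n → Fin n} → IsCoxeterMatrix m → IsTwist m σ →
  TwinEdgesSimple m → ∀ {s} → (∀ t → Conn m s t) → σ s ≡ s → (∀ t → σ t ≡ t) ⊎ ∃ (BadSubset m σ)
trivial-or-A₃ {n} {σ = σ} coxeter twist tes connected fixed with all? (λ t → σ t ≟ᶠ t)
... | yes trivial = inj₁ trivial
... | no ¬trivial with ¬∀⟶∃¬ n _ (λ t → σ t ≟ᶠ t) ¬trivial
...   | t , moved with moving-edge σ (connected t) fixed moved
...     | u , v , fixed-u , moved-v , edge = inj₂ (A₃-bad-subset coxeter twist tes fixed-u moved-v edge)

-- Classification

RHSFor : CoxType → Set
RHSFor X = ∀ {n} (m : CoxMatrix n) (σ : Fin n → Fin n) → WHasType m X → RHS m σ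

RHSForTrivial : CoxType → Set
RHSForTrivial X = ∀ {n} (m : CoxMatrix n) (σ : Fin n → Fin n) → (∀ s → σ s ≡ s) → WHasType m X → RHS m σ

data Shape (X : CoxType) : Set where
  listed            : RHSFor X → Shape X
  listed-if-trivial : TwinEdgesSimple (mat X) → RHSForTrivial X → Shape X
  obstructed        : TwinEdgesSimple (mat X) → Obstruction X → Shape X

BC₂-as-I₂ : ∀ {n} {m : CoxMatrix n} → WHasType m (typeBC 2) → WHasType m (typeI2 ⟨ 4 ⟩)
BC₂-as-I₂ (f , injective , inside , onto , preserves) =
  f , injective , inside , onto , λ i j → trans (preserves i j) (same i j)
  where
  same : ∀ i j → mat (typeBC 2) i j ≡ mat (typeI2 ⟨ 4 ⟩) i j
  same zero       zero       = refl
  same zero       (suc zero) = refl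
  same (suc zero) zero       = refl
  same (suc zero) (suc zero) = refl

shape : ∀ T → Shape (diagram T)
shape (A n n≥1) = listed-if-trivial (twinEdgesSimple-A n)
  λ _ _ trivial W → inj₂ (inj₁ (trivial , inj₁ (n , n≥1 , W)))
shape (BC 2 _) = listed λ m _ W →
  inj₂ (inj₂ (inj₂ (inj₂ (inj₂ (inj₁ (4 , s≤s (s≤s (s≤s z≤n)) , BC₂-as-I₂ {m = m} W))))))
shape (BC (suc (suc (suc k))) _) = obstructed (twinEdgesSimple-BC (suc k)) (inj₁ (BC₃-⊑-BC k))
shape (D (suc (suc (suc (suc k)))) _) = obstructed (twinEdgesSimple-D k) (inj₂ (inj₁ (D₄-⊑-D k)))
shape E6 = obstructed (twinEdgesSimple-by-check (typeE 6))
  (inj₂ (inj₁ (⊑-by-check (typeD 4) (typeE 6) (# 1 ∷ # 2 ∷ # 3 ∷ # 5 ∷ []))))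
shape E7 = obstructed (twinEdgesSimple-by-check (typeE 7))
  (inj₂ (inj₁ (⊑-by-check (typeD 4) (typeE 7) (# 1 ∷ # 2 ∷ # 3 ∷ # 6 ∷ []))))
shape E8 = obstructed (twinEdgesSimple-by-check (typeE 8))
  (inj₂ (inj₁ (⊑-by-check (typeD 4) (typeE 8) (# 1 ∷ # 2 ∷ # 3 ∷ # 7 ∷ []))))
shape F4 = obstructed (twinEdgesSimple-by-check typeF4)
  (inj₁ (⊑-by-check (typeBC 3) typeF4 (# 0 ∷ # 1 ∷ # 2 ∷ [])))
shape H3 = obstructed (twinEdgesSimple-by-check (typeH 3)) (inj₂ (inj₂ ⊑-refl))
shape H4 = obstructed (twinEdgesSimple-by-check (typeH 4))
  (inj₂ (inj₂ (⊑-by-check (typeH 3) (typeH 4) (# 0 ∷ # 1 ∷ # 2 ∷ []))))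
shape (I2 k k≥3) = listed λ _ _ W → inj₂ (inj₂ (inj₂ (inj₂ (inj₂ (inj₁ (k , k≥3 , W))))))
shape (Ã 1 _) = listed λ _ _ W → inj₂ (inj₂ (inj₂ (inj₂ (inj₂ (inj₂ W)))))
shape (Ã 2 _) = listed λ _ _ W → inj₂ (inj₂ (inj₁ W))
shape (Ã (suc (suc (suc j))) n≥1) = listed-if-trivial (twinEdgesSimple-Ã j)
  λ _ _ trivial W → inj₂ (inj₁ (trivial , inj₂ (3 + j , n≥1 , W)))
shape (B̃ (suc (suc (suc k))) _) =
  obstructed (twinEdgesSimple-B̃ k) (inj₁ (⊑-trans (BC₃-⊑-BC k) (BC-⊑-B̃ (3 + k))))
shape (C̃ 2 _) = listed λ _ _ W → inj₂ (inj₂ (inj₂ (inj₁ W)))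
shape (C̃ (suc (suc (suc k))) _) =
  obstructed (twinEdgesSimple-C̃ k) (inj₁ (⊑-trans (BC₃-⊑-BC k) (BC-⊑-C̃ (suc k))))
shape (D̃ (suc (suc (suc (suc k)))) _) =
  obstructed (twinEdgesSimple-D̃ k) (inj₂ (inj₁ (⊑-trans (D₄-⊑-D k) (D-⊑-D̃ (4 + k)))))
shape Ẽ6 = obstructed (twinEdgesSimple-by-check typeẼ6)
  (inj₂ (inj₁ (⊑-by-check (typeD 4) typeẼ6 (# 1 ∷ # 2 ∷ # 3 ∷ # 5 ∷ []))))
shape Ẽ7 = obstructed (twinEdgesSimple-by-check typeẼ7)
  (inj₂ (inj₁ (⊑-by-check (typeD 4) typeẼ7 (# 2 ∷ # 3 ∷ # 4 ∷ # 7 ∷ []))))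
shape Ẽ8 = obstructed (twinEdgesSimple-by-check typeẼ8)
  (inj₂ (inj₁ (⊑-by-check (typeD 4) typeẼ8 (# 1 ∷ # 2 ∷ # 3 ∷ # 8 ∷ []))))
shape F̃4 = obstructed (twinEdgesSimple-by-check typeF̃4)
  (inj₁ (⊑-by-check (typeBC 3) typeF̃4 (# 1 ∷ # 2 ∷ # 3 ∷ [])))
shape G̃2 = listed λ _ _ W → inj₂ (inj₂ (inj₂ (inj₂ (inj₁ W))))
shape (BC 0 ())
shape (BC 1 (s≤s ()))
shape (D 0 ())
shape (D 1 (s≤s ()))
shape (D 2 (s≤s (s≤s ())))
shape (D 3 (s≤s (s≤s (s≤s ()))))
shape (Ã 0 ())
shape (B̃ 0 ())
shape (B̃ 1 (s≤s ()))
shape (B̃ 2 (s≤s (s≤s ())))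
shape (C̃ 0 ())
shape (C̃ 1 (s≤s ()))
shape (D̃ 0 ())
shape (D̃ 1 (s≤s ()))
shape (D̃ 2 (s≤s (s≤s ())))
shape (D̃ 3 (s≤s (s≤s (s≤s ()))))

simplyBraided⇒RHS : ∀ {n} {m : CoxMatrix n} {σ : Fin n → Fin n} →
  IsCoxeterMatrix m → IsTwist m σ → Irreducible m σ → FiniteOrAffine m → SimplyBraided m σ → RHS m σ
simplyBraided⇒RHS {m = m} {σ} coxeter twist irreducible finite-or-affine simply-braided
  with any? (λ s → σ s ≟ᶠ s)
... | no none-fixed = inj₁ λ s fixed → none-fixed (s , fixed)
... | yes (s₀ , fixed) = from-shape (shape T)
  where
  T = proj₁ (finite-or-affine s₀)
  connected : ∀ t → Conn m s₀ t
  connected = connected-from-fixed twist irreducible fixed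
  W : WHasType m (diagram T)
  W = connected⇒WHasType connected (proj₂ (finite-or-affine s₀))
  trivial : TwinEdgesSimple (mat (diagram T)) → ∀ s → σ s ≡ s
  trivial tes with trivial-or-A₃ coxeter twist (WholeType.twinEdgesSimple m _ W tes) connected fixed
  ... | inj₁ σ≗id = σ≗id
  ... | inj₂ bad  = contradiction bad simply-braided
  from-shape : Shape (diagram T) → RHS m σ
  from-shape (listed rhs)                = rhs m σ W
  from-shape (listed-if-trivial tes rhs) = rhs m σ (trivial tes) W
  from-shape (obstructed tes obstruction) =
    contradiction (obstruction-bad-subset {m = m} W (trivial tes) obstruction) simply-braided

fixed-point-free⇒simplyBraided : ∀ {n} {m : CoxMatrix n} {σ : Fin n → Fin n} →
  (∀ s → σ s ≢ s) → SimplyBraided m σ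
fixed-point-free⇒simplyBraided {m = m} free (J , _ , inj₁ (parabolic , fixes)) =
  free (proj₁ member) (fixes _ (proj₂ member))
  where
  first : ∀ {B} → HasType m (_∈ J) B → Fin (rank B) → ∃ (_∈ J)
  first (h , _ , inside , _) i = h i , inside i
  member : ∃ (_∈ J)
  member = [ (λ P → first P (# 0)) , [ (λ P → first P (# 0)) , (λ P → first P (# 0)) ]′ ]′ parabolic
fixed-point-free⇒simplyBraided free (_ , _ , inj₂ (h , _ , σ∘h≗h∘opposite)) =
  free (h (# 1)) (σ∘h≗h∘opposite (# 1))

module _ {n} (m : CoxMatrix n) (σ : Fin n → Fin n) {X : CoxType} (W : WHasType m X) where
  open WholeType m X W

  obstruction-of-parabolic : ∀ {J} →
    HasType m (_∈ J) (typeBC 3) ⊎ HasType m (_∈ J) (typeD 4) ⊎ HasType m (_∈ J) (typeH 3) → Obstruction X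
  obstruction-of-parabolic = Sum.map parabolic⇒⊑ (Sum.map parabolic⇒⊑ parabolic⇒⊑)

  trivial-unobstructed⇒simplyBraided : ¬ Obstruction X → (∀ s → σ s ≡ s) → SimplyBraided m σ
  trivial-unobstructed⇒simplyBraided ¬obstruction _ (_ , _ , inj₁ (parabolic , _)) =
    ¬obstruction (obstruction-of-parabolic parabolic)
  trivial-unobstructed⇒simplyBraided _ trivial (_ , _ , inj₂ (h , (injective , _) , σ∘h≗h∘opposite))
    with injective (trans (sym (trivial (h (# 0)))) (σ∘h≗h∘opposite (# 0)))
  ... | ()

  unobstructed⇒simplyBraided : ¬ Obstruction X → ¬ (typeA 3 ⊑ X) → SimplyBraided m σ
  unobstructed⇒simplyBraided ¬obstruction _ (_ , _ , inj₁ (parabolic , _)) =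
    ¬obstruction (obstruction-of-parabolic parabolic)
  unobstructed⇒simplyBraided _ ¬A₃ (_ , _ , inj₂ (h , via , _)) = ¬A₃ (parabolic⇒⊑ (h , via))

RHS⇒simplyBraided : ∀ {n} (m : CoxMatrix n) (σ : Fin n → Fin n) → RHS m σ → SimplyBraided m σ
RHS⇒simplyBraided m σ (inj₁ free) = fixed-point-free⇒simplyBraided {m = m} free
RHS⇒simplyBraided m σ (inj₂ (inj₁ (trivial , inj₁ (k , _ , W)))) =
  trivial-unobstructed⇒simplyBraided m σ W (¬obstruction-A k) trivial
RHS⇒simplyBraided m σ (inj₂ (inj₁ (trivial , inj₂ (k , _ , W)))) =
  trivial-unobstructed⇒simplyBraided m σ W (¬obstruction-Ã k) trivial
RHS⇒simplyBraided m σ (inj₂ (inj₂ (inj₁ W))) =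
  unobstructed⇒simplyBraided m σ W (¬obstruction-Ã 2) (⋢-by-check (typeA 3) (typeÃ 2))
RHS⇒simplyBraided m σ (inj₂ (inj₂ (inj₂ (inj₁ W)))) =
  unobstructed⇒simplyBraided m σ W
    [ ⋢-by-check (typeBC 3) (typeC̃ 2) , [ ⋢-rank ≤-refl , ⋢-by-check (typeH 3) (typeC̃ 2) ]′ ]′
    (⋢-by-check (typeA 3) (typeC̃ 2))
RHS⇒simplyBraided m σ (inj₂ (inj₂ (inj₂ (inj₂ (inj₁ W))))) =
  unobstructed⇒simplyBraided m σ W
    [ ⋢-by-check (typeBC 3) typeG̃2 , [ ⋢-rank ≤-refl , ⋢-by-check (typeH 3) typeG̃2 ]′ ]′
    (⋢-by-check (typeA 3) typeG̃2)
RHS⇒simplyBraided m σ (inj₂ (inj₂ (inj₂ (inj₂ (inj₂ (inj₁ (_ , _ , W))))))) =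
  unobstructed⇒simplyBraided m σ W (¬obstruction-rank≤2 ≤-refl) (⋢-rank ≤-refl)
RHS⇒simplyBraided m σ (inj₂ (inj₂ (inj₂ (inj₂ (inj₂ (inj₂ W)))))) =
  unobstructed⇒simplyBraided m σ W (¬obstruction-rank≤2 ≤-refl) (⋢-rank ≤-refl)

proposition7p2 : ∀ {n : ℕ} (m : CoxMatrix n) (σ : Fin n → Fin n) →
    IsCoxeterMatrix m → IsTwist m σ → Irreducible m σ → FiniteOrAffine m →
    SimplyBraided m σ ⇔ RHS m σ
proposition7p2 m σ coxeter twist irreducible finite-or-affine =
  mk⇔ (simplyBraided⇒RHS coxeter twist irreducible finite-or-affine) (RHS⇒simplyBraided m σ)
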